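{- Let $F=(F_n)$ be a linear-like semiring family of graphs, and let $G,H$ be finite graphs such that $G\ltimes d\to H\ltimes d$ for some $d\in\mathbb{N}_+$ (equivalently, $G\to (H\ltimes d)/d$). Then $\eta_{F,f}(G)\le\eta_{F,f}(H)$.
   Context: Graphs are undirected simple graphs, possibly infinite; $X\to Y$ denotes existence of a graph homomorphism; $\omega$ is the clique number. The join $G+H$ is the disjoint union with all edges between the two parts added; the disjunctive product $G\ast H$ has vertex set $V(G)\times V(H)$ with $(v,w)\sim(v',w')$ iff $v\sim v'$ or $w\sim w'$. The lexicographic product $G\ltimes H$ has vertex set $V(G)\times V(H)$ with $(v,w)\sim(v',w')$ iff $v\sim v'$, or $v=v'$ and $w\sim w'$; $G\ltimes d:=G\ltimes K_d$. For $d\in\mathbb{N}_+$, $X/d$ is the graph of $d$-cliques of $X$, with $S\sim T$ iff $S\cap T=\emptyset$ and $s\sim t$ for all $s\in S,t\in T$. A semiring family is a sequence $(F_n)_{n\in\mathbb{N}}$ with $F_0=\emptyset$, $F_1\ne\emptyset$, and homomorphisms $F_n+F_m\to F_{n+m}$, $F_n\ast F_m\to F_{nm}$. For $S\subseteq V(X)$, $S^\perp$ is the set of vertices adjacent to all vertices of $S$; $S$ is a flat if $S^{\perp\perp}=S$; $\mathrm{rk}(S)=\omega(S^{\perp\perp})$. $(F_n)$ is linear-like if for every $n$ and every flat $S\subseteq V(F_n)$, the induced subgraph on $S$ is homomorphically equivalent to $F_{\mathrm{rk}(S)}$. For finite $G$, $\eta_{F,f}(G)=\inf\{n/d: n\in\mathbb{N},d\in\mathbb{N}_+,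 G\to F_n/d\}$. -}

module Defs where

open import Data.Nat using (ℕ; zero; suc; _+_; _*_; _<_)
open import Data.Fin using (Fin)
open import Data.Product using (Σ; ∃; _×_; _,_; proj₁; proj₂)
open import Data.Sum using (_⊎_; inj₁; inj₂)
open import Data.Empty using (⊥; ⊥-elim)
open import Data.Unit using (⊤; tt)
open import Relation.Nullary using (¬_)
open import Relation.Binary.PropositionalEquality using (_≡_; _≢_; refl; sym)
open import Function.Bundles using (_↔_)

record Graph : Set₁ where
  field
    V     : Set
    E     : V → V → Set
    E-sym : ∀ {u v} → E u v → E v u
    E-irr : ∀ {v} → ¬ E v v
open Graph public

Hom : Graph → Graph → Set
Hom X Y = Σ (V X → V Y) λ f → ∀ {u v} → E X u v → E Y (f u) (f v)

HomEquiv : Graph → Graph → Set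
HomEquiv X Y = Hom X Y × Hom Y X

Finite : Graph → Set
Finite X = Σ ℕ λ n → V X ↔ Fin n

K : ℕ → Graph
K d = record { V = Fin d ; E = λ i j → i ≢ j
             ; E-sym = λ p q → p (sym q) ; E-irr = λ p → p refl }

joinE : (G H : Graph) → V G ⊎ V H → V G ⊎ V H → Set
joinE G H (inj₁ a) (inj₁ b) = E G a b
joinE G H (inj₁ a) (inj₂ b) = ⊤
joinE G H (inj₂ a) (inj₁ b) = ⊤
joinE G H (inj₂ a) (inj₂ b) = E H a b

joinE-sym : (G H : Graph) → ∀ {u v} → joinE G H u v → joinE G H v u
joinE-sym G H {inj₁ a} {inj₁ b} e = E-sym G e
joinE-sym G H {inj₁ a} {inj₂ b} e = tt
joinE-sym G H {inj₂ a} {inj₁ b} e = tt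
joinE-sym G H {inj₂ a} {inj₂ b} e = E-sym H e

joinE-irr : (G H : Graph) → ∀ {v} → ¬ joinE G H v v
joinE-irr G H {inj₁ a} e = E-irr G e
joinE-irr G H {inj₂ a} e = E-irr H e

_⊕_ : Graph → Graph → Graph
G ⊕ H = record { V = V G ⊎ V H ; E = joinE G H
               ; E-sym = λ {u} {v} → joinE-sym G H {u} {v} ; E-irr = λ {v} → joinE-irr G H {v} }

_⊛_ : Graph → Graph → Graph
G ⊛ H = record
  { V = V G × V H
  ; E = λ p q → E G (proj₁ p) (proj₁ q) ⊎ E H (proj₂ p) (proj₂ q)
  ; E-sym = λ { (inj₁ e) → inj₁ (E-sym G e) ; (inj₂ e) → inj₂ (E-sym H e) }
  ; E-irr = λ { (inj₁ e) → E-irr G e ; (inj₂ e) → E-irr H e } }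

_⋉_ : Graph → Graph → Graph
G ⋉ H = record
  { V = V G × V H
  ; E = λ p q → E G (proj₁ p) (proj₁ q)
                ⊎ (proj₁ p ≡ proj₁ q × E H (proj₂ p) (proj₂ q))
  ; E-sym = λ { (inj₁ e) → inj₁ (E-sym G e)
              ; (inj₂ (eq , e)) → inj₂ (sym eq , E-sym H e) }
  ; E-irr = λ { (inj₁ e) → E-irr G e ; (inj₂ (_ , e)) → E-irr H e } }

Clique : Graph → ℕ → Set
Clique X d = Σ (Fin d → V X) λ s → ∀ i j → i ≢ j → E X (s i) (s j)

-- X / d for d = suc k ≥ 1: the graph of d-cliques, S ~ T iff S ∩ T = ∅ and
-- every vertex of S is adjacent to every vertex of T.
_÷suc_ : Graph → ℕ → Graph
X ÷suc k = record
  { V = Clique X (suc k)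
  ; E = λ S T → (∀ i j → proj₁ S i ≢ proj₁ T j)
                × (∀ i j → E X (proj₁ S i) (proj₁ T j))
  ; E-sym = λ { (d , a) → (λ i j eq → d j i (sym eq)) , (λ i j → E-sym X (a j i)) }
  ; E-irr = λ { (d , a) → d Fin.zero Fin.zero refl } }
  where import Data.Fin as Fin

record SemiringFamily (F : ℕ → Graph) : Set where
  field
    F0-empty : V (F 0) → ⊥
    F1-inhab : V (F 1)
    join-hom : ∀ n m → Hom (F n ⊕ F m) (F (n + m))
    prod-hom : ∀ n m → Hom (F n ⊛ F m) (F (n * m))

Subset : Graph → Set₁
Subset X = V X → Set

perp : (X : Graph) → Subset X → Subset X
perp X S v = ∀ s → S s → E X v s

IsFlat : (X : Graph) → Subset X → Set
IsFlat X S = ∀ v → (perp X (perp X S) v → S v) × (S v → perp X (perp X S) v)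

Induced : (X : Graph) → Subset X → Graph
Induced X S = record
  { V = Σ (V X) S
  ; E = λ p q → E X (proj₁ p) (proj₁ q)
  ; E-sym = E-sym X ; E-irr = E-irr X }

CliqueNumberIs : Graph → ℕ → Set
CliqueNumberIs X r = Clique X r × ¬ Clique X (suc r)

LinearLike : (ℕ → Graph) → Set₁
LinearLike F = ∀ n (S : Subset (F n)) → IsFlat (F n) S →
  Σ ℕ λ r → CliqueNumberIs (Induced (F n) (perp (F n) (perp (F n) S))) r
            × HomEquiv (Induced (F n) S) (F r)

-- "η_{F,f}(G) < a / (suc b)": some n/d in the defining set lies below a/(b+1).
EtaBelow : (ℕ → Graph) → Graph → ℕ → ℕ → Set
EtaBelow F G a b = Σ ℕ λ n → Σ ℕ λ k →
  Hom G (F n ÷suc k) × (n * suc b < a * suc k)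

-- η_{F,f}(G) ≤ η_{F,f}(H)  (as infima in [0,∞]): every nonnegative rational
-- strictly above η(H) is strictly above η(G).
EtaLe : (ℕ → Graph) → Graph → Graph → Set
EtaLe F G H = ∀ a b → EtaBelow F H a b → EtaBelow F G a b

-- A homomorphism H → F_n / m turns G ⋉ K_d → H ⋉ K_d into a map sending each
-- (g , c) to an m-clique of F_n tagged with colour c, i.e. an m-clique of
-- F_n ∗ K_d; composing with K_d → F_d and F_n ∗ F_d → F_{nd} gives m-cliques of
-- F_{nd}. For a fixed g the d cliques of the colours c are pairwise fully
-- adjacent, so their union is a dm-clique: G → F_{nd} / (dm), and every
-- fraction n/m witnessing η(H) yields nd/(dm) = n/m for G.
module Submission where

open import Defs
open import Data.Nat using (ℕ; suc; zero; _*_; _+_; _<_)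
open import Data.Nat.Properties using (*-monoˡ-<; *-comm; *-assoc)
open import Data.Fin using (Fin; remQuot; combine)
open import Data.Fin.Properties using (combine-remQuot) renaming (_≟_ to _≟ᶠ_)
open import Data.Product using (Σ; _×_; _,_; proj₁; proj₂; uncurry)
open import Data.Sum using (inj₁; inj₂)
open import Data.Unit using (tt)
open import Data.Empty using (⊥-elim)
open import Function using (_∘_)
open import Relation.Nullary using (yes; no)
open import Relation.Binary.PropositionalEquality

-- Hom X Y unfolds to a Σ-type, from which Agda cannot recover X and Y; this
-- record is indexed by them, so composition chains infer their endpoints.
record _⇒_ (X Y : Graph) : Set where
  constructor hom
  field
    map     : V X → V Y
    map-adj : ∀ {u v} → E X u v → E Y (map u) (map v)
open _⇒_

Hom→⇒ : {X Y : Graph} → Hom X Y → X ⇒ Y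
Hom→⇒ (f , f-adj) = hom f f-adj

⇒→Hom : {X Y : Graph} → X ⇒ Y → Hom X Y
⇒→Hom f = map f , map-adj f

infixr 2 _⇒⟨_⟩_
infix  3 _∎ʰ

_⇒⟨_⟩_ : (X : Graph) {Y Z : Graph} → X ⇒ Y → Y ⇒ Z → X ⇒ Z
X ⇒⟨ f ⟩ g = hom (map g ∘ map f) (map-adj g ∘ map-adj f)

_∎ʰ : (X : Graph) → X ⇒ X
X ∎ʰ = hom (λ x → x) (λ e → e)

adjacent⇒≢ : (X : Graph) → ∀ {u v} → E X u v → u ≢ v
adjacent⇒≢ X e refl = E-irr X e

÷-adjacent : (X : Graph) (k : ℕ) (S T : Clique X (suc k)) →
  (∀ i j → E X (proj₁ S i) (proj₁ T j)) → E (X ÷suc k) S T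
÷-adjacent X k S T adj = (λ i j → adjacent⇒≢ X (adj i j)) , adj

⋉-monoˡ : {X Y : Graph} (Z : Graph) → X ⇒ Y → (X ⋉ Z) ⇒ (Y ⋉ Z)
⋉-monoˡ Z f = hom (λ (x , z) → map f x , z) λ
  { (inj₁ e)          → inj₁ (map-adj f e)
  ; (inj₂ (refl , e)) → inj₂ (refl , e) }

⊛-monoʳ : (X : Graph) {Y Z : Graph} → Y ⇒ Z → (X ⊛ Y) ⇒ (X ⊛ Z)
⊛-monoʳ X f = hom (λ (x , y) → x , map f y) λ
  { (inj₁ e) → inj₁ e
  ; (inj₂ e) → inj₂ (map-adj f e) }

÷-mono : {X Y : Graph} (k : ℕ) → X ⇒ Y → (X ÷suc k) ⇒ (Y ÷suc k)
÷-mono {X} {Y} k f = hom image λ {S} {T} S~T →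
  ÷-adjacent Y k (image S) (image T) λ i j → map-adj f (proj₂ S~T i j)
  where
  image : Clique X (suc k) → Clique Y (suc k)
  image (s , s-clique) = map f ∘ s , λ i j i≢j → map-adj f (s-clique i j i≢j)

K⇒F : {F : ℕ → Graph} → SemiringFamily F → ∀ d → K d ⇒ F d
K⇒F SF zero = hom (λ ()) λ { {()} }
K⇒F {F} SF (suc d) =
  K (suc d)   ⇒⟨ hom point⊕K point⊕K-adj ⟩
  F 1 ⊕ F d   ⇒⟨ Hom→⇒ (join-hom 1 d) ⟩
  F (suc d)   ∎ʰ
  where
  open SemiringFamily SF
  import Data.Fin as Fin
  κ = K⇒F SF d
  point⊕K : Fin (suc d) → V (F 1 ⊕ F d)
  point⊕K Fin.zero    = inj₁ F1-inhab
  point⊕K (Fin.suc i) = inj₂ (map κ i)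
  point⊕K-adj : ∀ {i j} → E (K (suc d)) i j → E (F 1 ⊕ F d) (point⊕K i) (point⊕K j)
  point⊕K-adj {Fin.zero}  {Fin.zero}  i≢j = ⊥-elim (i≢j refl)
  point⊕K-adj {Fin.zero}  {Fin.suc j} _   = tt
  point⊕K-adj {Fin.suc i} {Fin.zero}  _   = tt
  point⊕K-adj {Fin.suc i} {Fin.suc j} i≢j = map-adj κ (i≢j ∘ cong Fin.suc)

÷⋉K⇒⊛K÷ : (X : Graph) (k d : ℕ) → ((X ÷suc k) ⋉ K d) ⇒ ((X ⊛ K d) ÷suc k)
÷⋉K⇒⊛K÷ X k d = hom colour λ {p} {q} p~q →
  ÷-adjacent (X ⊛ K d) k (colour p) (colour q) (colour-adj p q p~q)
  where
  colour : V ((X ÷suc k) ⋉ K d) → Clique (X ⊛ K d) (suc k)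
  colour ((s , s-clique) , c) = (λ i → s i , c) , λ i j i≢j → inj₁ (s-clique i j i≢j)
  colour-adj : ∀ p q → E ((X ÷suc k) ⋉ K d) p q →
    ∀ i j → E (X ⊛ K d) (proj₁ (colour p) i) (proj₁ (colour q) j)
  colour-adj _ _ (inj₁ S~T)           i j = inj₁ (proj₂ S~T i j)
  colour-adj _ _ (inj₂ (refl , c≢c')) i j = inj₂ c≢c'

remQuot-injective : ∀ {n} k {t t' : Fin (n * k)} → remQuot {n} k t ≡ remQuot k t' → t ≡ t'
remQuot-injective {n} k {t} {t'} eq = begin
  t                                  ≡⟨ combine-remQuot {n} k t ⟨
  uncurry combine (remQuot {n} k t)  ≡⟨ cong (uncurry combine) eq ⟩
  uncurry combine (remQuot {n} k t') ≡⟨ combine-remQuot {n} k t' ⟩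
  t'                                 ∎
  where open ≡-Reasoning

-- suc k * suc m reduces to suc (m + k * suc m), so the merged clique has
-- (k + 1)(m + 1) vertices, indexed through remQuot.
⋉K÷⇒÷ : (G Y : Graph) (k m : ℕ) →
  (G ⋉ K (suc k)) ⇒ (Y ÷suc m) → G ⇒ (Y ÷suc (m + k * suc m))
⋉K÷⇒÷ G Y k m f = hom merged λ {g} {g'} g~g' →
  ÷-adjacent Y (m + k * suc m) (merged g) (merged g') λ t t' →
    proj₂ (map-adj f (inj₁ g~g')) (proj₂ (remQuot {suc k} (suc m) t)) (proj₂ (remQuot {suc k} (suc m) t'))
  where
  member : V G → Fin (suc k) × Fin (suc m) → V Y
  member g (c , j) = proj₁ (map f (g , c)) j
  member-adj : ∀ g q q' → q ≢ q' → E Y (member g q) (member g q')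
  member-adj g (c , j) (c' , j') q≢q' with c ≟ᶠ c'
  ... | no c≢c'  = proj₂ (map-adj f (inj₂ (refl , c≢c'))) j j'
  ... | yes refl = proj₂ (map f (g , c)) j j' (q≢q' ∘ cong (c ,_))
  merged : V G → Clique Y (suc (m + k * suc m))
  merged g = member g ∘ remQuot {suc k} (suc m) , λ t t' t≢t' →
    member-adj g _ _ (t≢t' ∘ remQuot-injective {suc k} (suc m))

*-scale-< : ∀ {n b a m} d → n * b < a * m → n * suc d * b < a * (suc d * m)
*-scale-< {n} {b} {a} {m} d lt =
  subst₂ _<_ (*-swap-last n b) (*-assoc-swap a m) (*-monoˡ-< (suc d) lt)
  where
  open ≡-Reasoning
  *-assoc-swap : ∀ x y → x * y * suc d ≡ x * (suc d * y)
  *-assoc-swap x y = trans (*-assoc x y (suc d)) (cong (x *_) (*-comm y (suc d)))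
  *-swap-last : ∀ x y → x * y * suc d ≡ x * suc d * y
  *-swap-last x y = begin
    x * y * suc d   ≡⟨ *-assoc-swap x y ⟩
    x * (suc d * y) ≡⟨ *-assoc x (suc d) y ⟨
    x * suc d * y   ∎

lemma6p7 : (F : ℕ → Graph) → SemiringFamily F → LinearLike F →
    (G H : Graph) → Finite G → Finite H →
    Σ ℕ (λ k → Hom (G ⋉ K (suc k)) (H ⋉ K (suc k))) →
    EtaLe F G H
lemma6p7 F SF _ G H _ _ (k , G⋉d→H⋉d) a b (n , m , H→Fₙ/m , n/m<a/b) =
  n * d , m + k * suc m , ⇒→Hom (⋉K÷⇒÷ G (F (n * d)) k m G⋉d⇒Fₙd/m) ,
  *-scale-< {n} {suc b} {a} {suc m} k n/m<a/b
  where
  open SemiringFamily SF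
  d = suc k
  G⋉d⇒Fₙd/m : (G ⋉ K d) ⇒ (F (n * d) ÷suc m)
  G⋉d⇒Fₙd/m =
    G ⋉ K d              ⇒⟨ Hom→⇒ G⋉d→H⋉d ⟩
    H ⋉ K d              ⇒⟨ ⋉-monoˡ (K d) (Hom→⇒ H→Fₙ/m) ⟩
    (F n ÷suc m) ⋉ K d   ⇒⟨ ÷⋉K⇒⊛K÷ (F n) m d ⟩
    (F n ⊛ K d) ÷suc m   ⇒⟨ ÷-mono m (⊛-monoʳ (F n) (K⇒F SF d)) ⟩
    (F n ⊛ F d) ÷suc m   ⇒⟨ ÷-mono m (Hom→⇒ {F n ⊛ F d} {F (n * d)} (prod-hom n d)) ⟩
    F (n * d) ÷suc m     ∎ʰ
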